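{- Every prime interval order with no infinite antichain is at most countable and scattered.
   Context: A poset is an interval order if it is isomorphic to a set of nonempty intervals of some chain, ordered by $I<J$ iff $x<y$ for all $x\in I$, $y\in J$. A module of a poset $(V,\le)$ is a subset $A\subseteq V$ such that for all $a,a'\in A$ and $x\notin A$: $x\le a\iff x\le a'$ and $a\le x\iff a'\le x$. The empty set, singletons and $V$ are trivial modules; the poset is prime if it has no nontrivial module. A poset is scattered if it does not embed the chain $\mathbb{Q}$ of rationals. -}

module Defs where

open import Level using (0ℓ)
open import Data.Nat using (ℕ)
open import Data.Rational as ℚ using (ℚ)
open import Data.Product using (Σ; Σ-syntax; ∃; _×_)
open import Data.Sum using (_⊎_)
open import Relation.Nullary using (¬_)
open import Relation.Binary.PropositionalEquality using (_≡_)
open import Relation.Binary.Structures using (IsPartialOrder; IsTotalOrder)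
open import Function.Bundles using (_⇔_)
open import Function.Definitions using (Injective)

record Poset : Set₁ where
  field
    V      : Set
    _≤_    : V → V → Set
    isPO   : IsPartialOrder _≡_ _≤_

record Chain : Set₁ where
  field
    C        : Set
    _≤_      : C → C → Set
    isTotal  : IsTotalOrder _≡_ _≤_

  _<_ : C → C → Set
  x < y = (x ≤ y) × ¬ (x ≡ y)

  record Interval : Set₁ where
    field
      mem      : C → Set
      nonempty : Σ C mem
      convex   : ∀ x y z → mem x → mem z → x ≤ y → y ≤ z → mem y

  open Interval public

  _≺_ : Interval → Interval → Set
  I ≺ J = ∀ x y → mem I x → mem J y → x < y

  _≐_ : Interval → Interval → Set
  I ≐ J = ∀ x → (mem I x ⇔ mem J x)

module _ (P : Poset) where
  open Poset P

  _<_ : V → V → Set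
  u < v = (u ≤ v) × ¬ (u ≡ v)

  Incomparable : V → V → Set
  Incomparable u v = ¬ (u ≤ v) × ¬ (v ≤ u)

  -- P is isomorphic to a set of nonempty intervals of some chain,
  -- ordered by I < J iff x < y for all x ∈ I, y ∈ J:
  -- an injective map into intervals which preserves and reflects the strict order.
  IsIntervalOrder : Set₁
  IsIntervalOrder =
    Σ[ K ∈ Chain ] Σ[ f ∈ (V → Chain.Interval K) ]
      ((∀ u v → Chain._≐_ K (f u) (f v) → u ≡ v)
       × (∀ u v → (u < v) ⇔ Chain._≺_ K (f u) (f v)))

  IsModule : (V → Set) → Set
  IsModule A = ∀ a a' x → A a → A a' → ¬ A x →
    ((x ≤ a) ⇔ (x ≤ a')) × ((a ≤ x) ⇔ (a' ≤ x))

  IsTrivial : (V → Set) → Set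
  IsTrivial A =
    (∀ v → ¬ A v)
    ⊎ (Σ[ v ∈ V ] (∀ w → A w ⇔ (w ≡ v)))
    ⊎ (∀ v → A v)

  IsPrime : Set₁
  IsPrime = ∀ (A : V → Set) → IsModule A → IsTrivial A

  InfiniteAntichain : Set
  InfiniteAntichain =
    Σ[ s ∈ (ℕ → V) ] (Injective _≡_ _≡_ s × (∀ i j → ¬ (i ≡ j) → Incomparable (s i) (s j)))

  NoInfiniteAntichain : Set
  NoInfiniteAntichain = ¬ InfiniteAntichain

  AtMostCountable : Set
  AtMostCountable = Σ[ f ∈ (V → ℕ) ] Injective _≡_ _≡_ f

  EmbedsQ : Set
  EmbedsQ = Σ[ g ∈ (ℚ → V) ] (∀ p q → (p ℚ.≤ q) ⇔ (g p ≤ g q))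

  Scattered : Set
  Scattered = ¬ EmbedsQ

{-# OPTIONS --safe #-}
-- Both conclusions come from building an infinite antichain. In a 2+2-free poset, nested
-- pairs u ⊏ u′ ⊏ v′ ⊏ v, each with a witness incomparable to u′ and v′ but comparable to
-- some element strictly between u and v, have pairwise incomparable witnesses. Primeness
-- provides such a narrowing at every stage, because otherwise a suitable set would be a
-- nontrivial module.
--
-- For scatteredness the pairs are images of rationals, and the module is the span of the
-- image of a rational interval. For countability, call two intervals crossing when they
-- overlap and neither contains the other. The intervals crossing a fixed one form two
-- antichains, so components of the crossing graph are countable. Primeness puts all
-- non-atoms (intervals not contained in every interval they meet) in one component. The
-- remaining intervals are pairwise disjoint, so they form a chain, and primeness separates
-- any two of them by one of countably many cuts coming from that component. Hence an
-- uncountable such chain has an uncountable segment. In that segment each core element is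
-- either incomparable to everything or incomparable to only countably many elements (the
-- alternative is a narrowing). Any two of the remaining elements are then shielded, and the
-- intervals inside their hull form a nontrivial module.
module Submission where

open import Defs
open import Level using (Level)
open import Axiom.ExcludedMiddle using (ExcludedMiddle)
open import Axiom.DoubleNegationElimination using (em⇒dne)
open import Data.Bool using (Bool; true; false)
open import Data.Empty using (⊥; ⊥-elim)
open import Data.Maybe using (Maybe; just; nothing)
open import Data.Maybe.Properties using (just-injective)
open import Data.Nat as ℕ using (ℕ; zero; suc; _+_; _≤′_; ≤′-refl; ≤′-step)
open import Data.Nat.Properties using (+-suc; +-identityʳ; ≤⇒≤′; <-cmp)
open import Data.Product using (Σ; Σ-syntax; ∃; ∃-syntax; _×_; _,_; proj₁; proj₂)
open import Data.Rational as ℚ using (ℚ; 0ℚ; 1ℚ)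
import Data.Rational.Properties as ℚₚ
open import Data.Sum using (_⊎_; inj₁; inj₂; [_,_])
open import Data.Unit using (⊤; tt)
open import Function.Base using (case_of_; flip; id)
open import Function.Bundles using (_⇔_; mk⇔; Equivalence)
open import Function.Definitions using (Injective)
open import Relation.Nullary using (¬_; Dec; yes; no)
open import Relation.Binary.Definitions using (tri<; tri≈; tri>)
open import Relation.Binary.PropositionalEquality using (_≡_; _≢_; refl; sym; trans; cong; subst)
open import Relation.Binary.Structures using (IsPartialOrder; IsTotalOrder)

diagonal-step : ℕ × ℕ → ℕ × ℕ
diagonal-step (zero , j)  = suc j , zero
diagonal-step (suc i , j) = i , suc j

unpair : ℕ → ℕ × ℕ
unpair zero    = zero , zero
unpair (suc n) = diagonal-step (unpair n)

unpair-walk : ∀ n i j → unpair n ≡ (j + i , 0) → unpair (j + n) ≡ (i , j)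
unpair-walk n i zero    h = h
unpair-walk n i (suc j) h =
  cong diagonal-step (unpair-walk n (suc i) j (trans h (cong (_, 0) (sym (+-suc j i)))))

unpair-diagonal : ∀ s → ∃[ n ] unpair n ≡ (s , 0)
unpair-diagonal zero    = zero , refl
unpair-diagonal (suc s) =
  let n , h = unpair-diagonal s
  in suc (s + n) , cong diagonal-step (unpair-walk n 0 s (trans h (cong (_, 0) (sym (+-identityʳ s)))))

unpair-surjective : ∀ i j → ∃[ n ] unpair n ≡ (i , j)
unpair-surjective i j = let n , h = unpair-diagonal (j + i) in j + n , unpair-walk n i j h

Range : {A : Set} → (ℕ → Maybe A) → A → Set
Range e a = ∃[ n ] e n ≡ just a

Countable : {A : Set} → (A → Set) → Set
Countable {A} S = Σ[ e ∈ (ℕ → Maybe A) ] (∀ a → S a → Range e a)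

module _ {A : Set} where

  countable-⊆ : {S T : A → Set} → (∀ a → S a → T a) → Countable T → Countable S
  countable-⊆ S⊆T (e , cover) = e , λ a s → cover a (S⊆T a s)

  countable-∅ : {S : A → Set} → (∀ a → ¬ S a) → Countable S
  countable-∅ empty = (λ _ → nothing) , λ a s → ⊥-elim (empty a s)

  countable-singleton : (a : A) → Countable (_≡ a)
  countable-singleton a = (λ _ → just a) , λ { _ refl → 0 , refl }

  countable-Range : (e : ℕ → Maybe A) → Countable (Range e)
  countable-Range e = e , λ _ r → r

  countable-⋃ : {S : ℕ → A → Set} → (∀ i → Countable (S i)) → Countable (λ a → ∃[ i ] S i a)
  countable-⋃ {S} countable = e , cover
    where
      e : ℕ → Maybe A
      e n = proj₁ (countable (proj₁ (unpair n))) (proj₂ (unpair n))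

      cover : ∀ a → ∃[ i ] S i a → Range e a
      cover a (i , s) =
        let j , eq = proj₂ (countable i) a s
            n , un = unpair-surjective i j
        in n , trans (cong (λ p → proj₁ (countable (proj₁ p)) (proj₂ p)) un) eq

  countable-∪ : {S T : A → Set} → Countable S → Countable T → Countable (λ a → S a ⊎ T a)
  countable-∪ {S} {T} cS cT = countable-⊆ tag (countable-⋃ family-countable)
    where
      Family : ℕ → A → Set
      Family zero    = S
      Family (suc _) = T

      family-countable : ∀ i → Countable (Family i)
      family-countable zero    = cS
      family-countable (suc _) = cT

      tag : ∀ a → S a ⊎ T a → ∃[ i ] Family i a
      tag a (inj₁ s) = 0 , s
      tag a (inj₂ t) = 1 , t

  countable-⋃-indexed : {I : Set} {Ix : I → Set} {S : I → A → Set} →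
    Countable Ix → (∀ i → Countable (S i)) → Countable (λ a → ∃[ i ] Ix i × S i a)
  countable-⋃-indexed {Ix = Ix} {S} (e , cover) countable =
    countable-⊆ via (countable-⋃ piece-countable)
    where
      Piece : ℕ → A → Set
      Piece n a = ∃[ i ] e n ≡ just i × S i a

      piece-countable : ∀ n → Countable (Piece n)
      piece-countable n with e n
      ... | nothing = countable-∅ λ { a (i , () , _) }
      ... | just i  = countable-⊆ (λ { a (i , refl , s) → s }) (countable i)

      via : ∀ a → ∃[ i ] Ix i × S i a → ∃[ n ] Piece n a
      via a (i , ix , s) = let n , en = cover i ix in n , i , en , s

countable-universe⇒injection : {A : Set} → Countable {A} (λ _ → ⊤) → Σ[ f ∈ (A → ℕ) ] Injective _≡_ _≡_ f
countable-universe⇒injection (e , cover) = (λ a → proj₁ (cover a tt)) , λ {a} {b} eq →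
  just-injective (trans (sym (proj₂ (cover a tt))) (trans (cong e eq) (proj₂ (cover b tt))))

module Classical (em : ∀ {ℓ : Level} → ExcludedMiddle ℓ) where

  dne : ∀ {ℓ} {X : Set ℓ} → ¬ ¬ X → X
  dne = em⇒dne em

  ¬∀⇒∃¬ : ∀ {X : Set} {B Q : X → Set} → ¬ (∀ x → B x → Q x) → ∃[ x ] B x × ¬ Q x
  ¬∀⇒∃¬ ¬∀ = dne λ ¬∃ → ¬∀ λ x b → dne λ ¬q → ¬∃ (x , b , ¬q)

  module _ {A : Set} where

    countable-subsingleton : {S : A → Set} → (∀ a b → S a → S b → a ≡ b) → Countable S
    countable-subsingleton {S} unique with em {P = ∃ S}
    ... | yes (a , s) = countable-⊆ (λ b t → unique b a t s) (countable-singleton a)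
    ... | no ¬∃       = countable-∅ λ a s → ¬∃ (a , s)

    uncountable-∖ : {S T : A → Set} → ¬ Countable S → Countable T → ∃[ a ] S a × ¬ T a
    uncountable-∖ ¬cS cT = dne λ none → ¬cS (countable-⊆ (λ a s → dne λ ¬t → none (a , s , ¬t)) cT)

    countable-by-parts : {S T : A → Set} → Countable T → Countable (λ a → S a × ¬ T a) → Countable S
    countable-by-parts {S} {T} cT cS∖T = countable-⊆ split (countable-∪ cS∖T cT)
      where
        split : ∀ a → S a → S a × ¬ T a ⊎ T a
        split a s with em {P = T a}
        ... | yes t = inj₂ t
        ... | no ¬t = inj₁ (s , ¬t)

    uncountable⇒nonempty : {S : A → Set} → ¬ Countable S → ∃ S
    uncountable⇒nonempty ¬cS =
      let a , s , _ = uncountable-∖ {T = λ _ → ⊥} ¬cS (countable-∅ λ _ ()) in a , s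

    uncountable⇒distinct : {S : A → Set} → ¬ Countable S → ∃[ a ] ∃[ b ] S a × S b × a ≢ b
    uncountable⇒distinct ¬cS =
      let a , sa = uncountable⇒nonempty ¬cS
          b , sb , b≢a = uncountable-∖ ¬cS (countable-singleton a)
      in a , b , sa , sb , λ a≡b → b≢a (sym a≡b)

    module _ {S : A → Set} (¬cS : ¬ Countable S) where

      private
        enumeration : ℕ → ℕ → Maybe A
        fresh : ∀ n → ∃[ a ] S a × ¬ Range (enumeration n) a

        enumeration zero    _       = nothing
        enumeration (suc n) zero    = just (proj₁ (fresh n))
        enumeration (suc n) (suc k) = enumeration n k

        fresh n = uncountable-∖ ¬cS (countable-Range (enumeration n))

        range-grows : ∀ {m n a} → m ≤′ n → Range (enumeration m) a → Range (enumeration n) a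
        range-grows ≤′-refl        r = r
        range-grows (≤′-step m≤′n) r = let k , eq = range-grows m≤′n r in suc k , eq

      uncountable⇒sequence :
        Σ[ s ∈ (ℕ → A) ] (∀ n → S (s n)) × (∀ {i j} → i ℕ.< j → s i ≢ s j)
      uncountable⇒sequence = (λ n → proj₁ (fresh n)) , (λ n → proj₁ (proj₂ (fresh n))) , distinct
        where
          distinct : ∀ {i j} → i ℕ.< j → proj₁ (fresh i) ≢ proj₁ (fresh j)
          distinct {i} {j} i<j eq =
            proj₂ (proj₂ (fresh j)) (subst (Range (enumeration j)) eq (range-grows (≤⇒≤′ i<j) (0 , refl)))

⇔-true : {X Y : Set} → X → Y → X ⇔ Y
⇔-true x y = mk⇔ (λ _ → y) (λ _ → x)

⇔-false : {X Y : Set} → ¬ X → ¬ Y → X ⇔ Y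
⇔-false ¬x ¬y = mk⇔ (λ x → ⊥-elim (¬x x)) (λ y → ⊥-elim (¬y y))

module PosetLemmas (em : ∀ {ℓ : Level} → ExcludedMiddle ℓ) (P : Poset) where
  open Classical em
  open Poset P
  open IsPartialOrder isPO public using (antisym) renaming (refl to ≤-refl; trans to ≤-trans)

  infix 4 _⊏_ _∥_

  _⊏_ : V → V → Set
  _⊏_ = _<_ P

  _∥_ : V → V → Set
  _∥_ = Incomparable P

  Comparable : V → V → Set
  Comparable x y = x ≤ y ⊎ y ≤ x

  ≤⇒≡⊎⊏ : ∀ {x y} → x ≤ y → x ≡ y ⊎ x ⊏ y
  ≤⇒≡⊎⊏ {x} {y} x≤y with em {P = x ≡ y}
  ... | yes x≡y = inj₁ x≡y
  ... | no x≢y  = inj₂ (x≤y , x≢y)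

  ⊏-trans : ∀ {x y z} → x ⊏ y → y ⊏ z → x ⊏ z
  ⊏-trans (x≤y , x≢y) (y≤z , _) = ≤-trans x≤y y≤z , λ { refl → x≢y (antisym x≤y y≤z) }

  ⊏-≤-trans : ∀ {x y z} → x ⊏ y → y ≤ z → x ⊏ z
  ⊏-≤-trans x⊏y y≤z with ≤⇒≡⊎⊏ y≤z
  ... | inj₁ refl = x⊏y
  ... | inj₂ y⊏z  = ⊏-trans x⊏y y⊏z

  ≤-⊏-trans : ∀ {x y z} → x ≤ y → y ⊏ z → x ⊏ z
  ≤-⊏-trans x≤y y⊏z with ≤⇒≡⊎⊏ x≤y
  ... | inj₁ refl = y⊏z
  ... | inj₂ x⊏y  = ⊏-trans x⊏y y⊏z

  ⊏-irrefl : ∀ {x} → ¬ x ⊏ x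
  ⊏-irrefl (_ , x≢x) = x≢x refl

  ⊏-asym : ∀ {x y} → x ⊏ y → ¬ y ⊏ x
  ⊏-asym x⊏y y⊏x = ⊏-irrefl (⊏-trans x⊏y y⊏x)

  ∥-sym : ∀ {x y} → x ∥ y → y ∥ x
  ∥-sym (x≰y , y≰x) = y≰x , x≰y

  ∥⇒≢ : ∀ {x y} → x ∥ y → x ≢ y
  ∥⇒≢ (x≰y , _) refl = x≰y ≤-refl

  ¬⊏¬⊐⇒∥ : ∀ {x y} → x ≢ y → ¬ x ⊏ y → ¬ y ⊏ x → x ∥ y
  ¬⊏¬⊐⇒∥ x≢y x⊀y y⊀x = (λ x≤y → x⊀y (x≤y , x≢y)) , (λ y≤x → y⊀x (y≤x , λ y≡x → x≢y (sym y≡x)))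

  ¬∥⇒comparable : ∀ {x y} → ¬ x ∥ y → Comparable x y
  ¬∥⇒comparable {x} {y} ¬x∥y with em {P = x ≤ y} | em {P = y ≤ x}
  ... | yes x≤y | _       = inj₁ x≤y
  ... | no _    | yes y≤x = inj₂ y≤x
  ... | no x≰y  | no y≰x  = ⊥-elim (¬x∥y (x≰y , y≰x))

  ∥-between : ∀ {x a b w} → x ∥ a → x ∥ b → a ≤ w → w ≤ b → x ∥ w
  ∥-between (_ , a≰x) (x≰b , _) a≤w w≤b =
    (λ x≤w → x≰b (≤-trans x≤w w≤b)) , (λ w≤x → a≰x (≤-trans a≤w w≤x))

  data Uniform (S : V → Set) (x : V) : Set where
    below : (∀ a → S a → x ≤ a) → Uniform S x
    above : (∀ a → S a → a ≤ x) → Uniform S x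
    apart : (∀ a → S a → x ∥ a) → Uniform S x

  uniform⇒module : {S : V → Set} → (∀ x → ¬ S x → Uniform S x) → IsModule P S
  uniform⇒module {S} uniform a a' x sa sa' ¬sx with uniform x ¬sx
  ... | below x≤ =
    ⇔-true (x≤ a sa) (x≤ a' sa') , ⇔-false (not-above sa (x≤ a sa)) (not-above sa' (x≤ a' sa'))
    where
      not-above : ∀ {b} → S b → x ≤ b → ¬ b ≤ x
      not-above sb x≤b b≤x = ¬sx (subst S (antisym b≤x x≤b) sb)
  ... | above ≤x =
    ⇔-false (not-below sa (≤x a sa)) (not-below sa' (≤x a' sa')) , ⇔-true (≤x a sa) (≤x a' sa')
    where
      not-below : ∀ {b} → S b → b ≤ x → ¬ x ≤ b
      not-below sb b≤x x≤b = ¬sx (subst S (antisym b≤x x≤b) sb)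
  ... | apart x∥ =
    ⇔-false (proj₁ (x∥ a sa)) (proj₁ (x∥ a' sa')) , ⇔-false (proj₂ (x∥ a sa)) (proj₂ (x∥ a' sa'))

  prime-module-full : IsPrime P → {S : V → Set} → IsModule P S →
    ∀ {a b} → S a → S b → a ≢ b → ∀ c → S c
  prime-module-full prime {S} isModule sa sb a≢b with prime S isModule
  ... | inj₁ empty                  = ⊥-elim (empty _ sa)
  ... | inj₂ (inj₁ (v , singleton)) =
    ⊥-elim (a≢b (trans (Equivalence.to (singleton _) sa) (sym (Equivalence.to (singleton _) sb))))
  ... | inj₂ (inj₂ full)            = full

  sequence⇒antichain : (s : ℕ → V) → (∀ {i j} → i ℕ.< j → s i ∥ s j) → InfiniteAntichain P
  sequence⇒antichain s later-∥ = s , injective , pairwise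
    where
      pairwise : ∀ i j → i ≢ j → s i ∥ s j
      pairwise i j i≢j with <-cmp i j
      ... | tri< i<j _ _ = later-∥ i<j
      ... | tri≈ _ i≡j _ = ⊥-elim (i≢j i≡j)
      ... | tri> _ _ j<i = ∥-sym (later-∥ j<i)

      injective : ∀ {i j} → s i ≡ s j → i ≡ j
      injective {i} {j} si≡sj with i ℕ.≟ j
      ... | yes i≡j = i≡j
      ... | no i≢j  = ⊥-elim (∥⇒≢ (pairwise i j i≢j) si≡sj)

  antichain-countable : NoInfiniteAntichain P → {S : V → Set} →
    (∀ {a b} → S a → S b → a ≢ b → a ∥ b) → Countable S
  antichain-countable noAntichain antichain = dne λ ¬cS →
    let s , s∈S , distinct = uncountable⇒sequence ¬cS
    in noAntichain (sequence⇒antichain s λ {i} {j} i<j → antichain (s∈S i) (s∈S j) (distinct i<j))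

  Segment : (V → Set) → V → V → V → Set
  Segment Y a b z = Y z × a ⊏ z × z ⊏ b

  module _ {I : Set} {Ix : I → Set} (U : I → V → Set) {Y : V → Set}
           (Ix-countable : Countable Ix)
           (U-upward : ∀ i {a b} → U i a → a ⊏ b → U i b)
           (Y-chain : ∀ {a b} → Y a → Y b → a ≢ b → a ⊏ b ⊎ b ⊏ a)
           (separated : ∀ {a b} → Y a → Y b → a ⊏ b → ∃[ i ] Ix i × U i b × ¬ U i a) where

    private
      Maximal Minimal : V → Set
      Maximal z = Y z × ¬ (∃[ z′ ] Y z′ × z ⊏ z′)
      Minimal z = Y z × ¬ (∃[ z′ ] Y z′ × z′ ⊏ z)

      maximal-unique : ∀ a b → Maximal a → Maximal b → a ≡ b
      maximal-unique a b (ya , a-max) (yb , b-max) = dne λ a≢b →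
        [ (λ a⊏b → a-max (b , yb , a⊏b)) , (λ b⊏a → b-max (a , ya , b⊏a)) ] (Y-chain ya yb a≢b)

      minimal-unique : ∀ a b → Minimal a → Minimal b → a ≡ b
      minimal-unique a b (ya , a-min) (yb , b-min) = dne λ a≢b →
        [ (λ a⊏b → b-min (a , ya , a⊏b)) , (λ b⊏a → a-min (b , yb , b⊏a)) ] (Y-chain ya yb a≢b)

      Upper : I → Set
      Upper i = ∃[ h ] Y h × U i h

      Lower : I → Set
      Lower j = ∃[ l ] Y l × ¬ U j l

      -- every non-extremal element of Y lies in some Piece: below the chosen element of
      -- Y ∩ U i for an i separating it from a larger one, above the chosen element of
      -- Y ∖ U j for a j separating a smaller one from it
      Piece : ∀ {i j} → Dec (Upper i) → Dec (Lower j) → V → Set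
      Piece (yes (h , _)) (yes (l , _)) = Segment Y l h
      Piece _             _             = λ _ → ⊥

      piece-countable : (∀ {a b} → Y a → Y b → a ⊏ b → Countable (Segment Y a b)) →
        ∀ {i j} (dᵢ : Dec (Upper i)) (dⱼ : Dec (Lower j)) → Countable (Piece dᵢ dⱼ)
      piece-countable segments (yes (h , yh , _)) (yes (l , yl , _)) with em {P = l ⊏ h}
      ... | yes l⊏h = segments yl yh l⊏h
      ... | no l⋢h  = countable-∅ λ z (_ , l⊏z , z⊏h) → l⋢h (⊏-trans l⊏z z⊏h)
      piece-countable _ (yes _) (no _)  = countable-∅ λ _ ()
      piece-countable _ (no _)  (yes _) = countable-∅ λ _ ()
      piece-countable _ (no _)  (no _)  = countable-∅ λ _ ()

      Pieces : V → Set
      Pieces z = ∃[ i ] Ix i × ∃[ j ] Ix j × Piece (em {P = Upper i}) (em {P = Lower j}) z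

      in-piece : ∀ {z z′ z″ i j} → Y z → Y z′ → Y z″ → U i z′ → ¬ U i z → U j z → ¬ U j z″ →
        (dᵢ : Dec (Upper i)) (dⱼ : Dec (Lower j)) → Piece dᵢ dⱼ z
      in-piece {z} {i = i} {j} yz yz′ yz″ uᵢz′ ¬uᵢz uⱼz ¬uⱼz″ (yes (h , yh , uᵢh)) (yes (l , yl , ¬uⱼl)) =
        yz , l⊏z , z⊏h
        where
          z⊏h : z ⊏ h
          z⊏h = [ (λ z⊏h → z⊏h) , (λ h⊏z → ⊥-elim (¬uᵢz (U-upward i uᵢh h⊏z))) ]
                  (Y-chain yz yh λ { refl → ¬uᵢz uᵢh })
          l⊏z : l ⊏ z
          l⊏z = [ (λ l⊏z → l⊏z) , (λ z⊏l → ⊥-elim (¬uⱼl (U-upward j uⱼz z⊏l))) ]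
                  (Y-chain yl yz λ { refl → ¬uⱼl uⱼz })
      in-piece {z′ = z′} yz yz′ yz″ uᵢz′ _ _ _ (no none) _ = none (z′ , yz′ , uᵢz′)
      in-piece {z″ = z″} yz yz′ yz″ _ _ _ ¬uⱼz″ (yes _) (no none) = none (z″ , yz″ , ¬uⱼz″)

      cover : ∀ z → Y z → Maximal z ⊎ Minimal z ⊎ Pieces z
      cover z yz with em {P = ∃[ z′ ] Y z′ × z ⊏ z′} | em {P = ∃[ z″ ] Y z″ × z″ ⊏ z}
      ... | no z-max | _ = inj₁ (yz , z-max)
      ... | yes _ | no z-min = inj₂ (inj₁ (yz , z-min))
      ... | yes (z′ , yz′ , z⊏z′) | yes (z″ , yz″ , z″⊏z) =
        let i , ixᵢ , uᵢz′ , ¬uᵢz = separated yz yz′ z⊏z′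
            j , ixⱼ , uⱼz , ¬uⱼz″ = separated yz″ yz z″⊏z
        in inj₂ (inj₂ (i , ixᵢ , j , ixⱼ , in-piece yz yz′ yz″ uᵢz′ ¬uᵢz uⱼz ¬uⱼz″ em em))

    countable-chain : (∀ {a b} → Y a → Y b → a ⊏ b → Countable (Segment Y a b)) → Countable Y
    countable-chain segments =
      countable-⊆ cover
        (countable-∪ (countable-subsingleton maximal-unique)
          (countable-∪ (countable-subsingleton minimal-unique)
            (countable-⋃-indexed Ix-countable λ i →
              countable-⋃-indexed Ix-countable λ j → piece-countable segments em em)))

    uncountable-chain⇒uncountable-segment : ¬ Countable Y →
      ∃[ a ] ∃[ b ] Y a × Y b × a ⊏ b × ¬ Countable (Segment Y a b)
    uncountable-chain⇒uncountable-segment ¬cY = dne λ none →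
      ¬cY (countable-chain λ ya yb a⊏b → dne λ ¬c → none (_ , _ , ya , yb , a⊏b , ¬c))

  TwoPlusTwoFree : Set
  TwoPlusTwoFree = ∀ {a b c d} → a ⊏ b → c ⊏ d → a ⊏ d ⊎ c ⊏ b

  record Narrowing (Good : V → V → Set) (u v : V) : Set where
    field
      u′ v′ witness probe : V
      u⊏u′          : u ⊏ u′
      u′⊏v′         : u′ ⊏ v′
      v′⊏v          : v′ ⊏ v
      witness∥u′    : witness ∥ u′
      witness∥v′    : witness ∥ v′
      u⊏probe       : u ⊏ probe
      probe⊏v       : probe ⊏ v
      witness~probe : Comparable witness probe
      good          : Good u′ v′

  module _ (2+2-free : TwoPlusTwoFree) (Good : V → V → Set) (start : ∃[ u ] ∃[ v ] Good u v)
           (narrow : ∀ {u v} → Good u v → Narrowing Good u v) where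
    open Narrowing

    private
      stage : ℕ → ∃[ u ] ∃[ v ] Good u v
      step  : ∀ n → Narrowing Good (proj₁ (stage n)) (proj₁ (proj₂ (stage n)))

      stage zero    = start
      stage (suc n) = u′ (step n) , v′ (step n) , good (step n)

      step n = narrow (proj₂ (proj₂ (stage n)))

      lower upper : ℕ → V
      lower n = proj₁ (stage n)
      upper n = proj₁ (proj₂ (stage n))

      nested : ∀ {i j} → i ≤′ j → lower i ≤ lower j × upper j ≤ upper i
      nested ≤′-refl          = ≤-refl , ≤-refl
      nested (≤′-step {n = j} i≤′j) =
        let l , u = nested i≤′j
        in ≤-trans l (proj₁ (u⊏u′ (step j))) , ≤-trans (proj₁ (v′⊏v (step j))) u

      witness-∥-later : ∀ {i j w} → i ℕ.< j → lower j ≤ w → w ≤ upper j → witness (step i) ∥ w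
      witness-∥-later {i} i<j l≤w w≤u =
        let l , u = nested (≤⇒≤′ i<j)
        in ∥-between (witness∥u′ (step i)) (witness∥v′ (step i)) (≤-trans l l≤w) (≤-trans w≤u u)

      witnesses-∥ : ∀ {i j} → i ℕ.< j → witness (step i) ∥ witness (step j)
      witnesses-∥ {i} {j} i<j = xᵢ≰xⱼ , xⱼ≰xᵢ
        where
          N : Narrowing Good (lower j) (upper j)
          N = step j
          xᵢ xⱼ : V
          xᵢ = witness (step i)
          xⱼ = witness N
          xᵢ∥u′ : xᵢ ∥ u′ N
          xᵢ∥u′ = witness-∥-later i<j (proj₁ (u⊏u′ N)) (proj₁ (⊏-trans (u′⊏v′ N) (v′⊏v N)))
          xᵢ∥v′ : xᵢ ∥ v′ N
          xᵢ∥v′ = witness-∥-later i<j (proj₁ (⊏-trans (u⊏u′ N) (u′⊏v′ N))) (proj₁ (v′⊏v N))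
          xᵢ≢xⱼ : xᵢ ≢ xⱼ
          xᵢ≢xⱼ xᵢ≡xⱼ with witness-∥-later i<j (proj₁ (u⊏probe N)) (proj₁ (probe⊏v N)) | witness~probe N
          ... | x≰t , _ | inj₁ x≤t = x≰t (subst (_≤ probe N) (sym xᵢ≡xⱼ) x≤t)
          ... | _ , t≰x | inj₂ t≤x = t≰x (subst (probe N ≤_) (sym xᵢ≡xⱼ) t≤x)
          xᵢ≰xⱼ : ¬ xᵢ ≤ xⱼ
          xᵢ≰xⱼ xᵢ≤xⱼ with ≤⇒≡⊎⊏ xᵢ≤xⱼ
          ... | inj₁ xᵢ≡xⱼ = xᵢ≢xⱼ xᵢ≡xⱼ
          ... | inj₂ xᵢ⊏xⱼ with 2+2-free xᵢ⊏xⱼ (u′⊏v′ N)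
          ...   | inj₁ xᵢ⊏v′ = proj₁ xᵢ∥v′ (proj₁ xᵢ⊏v′)
          ...   | inj₂ u′⊏xⱼ = proj₂ (witness∥u′ N) (proj₁ u′⊏xⱼ)
          xⱼ≰xᵢ : ¬ xⱼ ≤ xᵢ
          xⱼ≰xᵢ xⱼ≤xᵢ with ≤⇒≡⊎⊏ xⱼ≤xᵢ
          ... | inj₁ xⱼ≡xᵢ = xᵢ≢xⱼ (sym xⱼ≡xᵢ)
          ... | inj₂ xⱼ⊏xᵢ with 2+2-free xⱼ⊏xᵢ (u′⊏v′ N)
          ...   | inj₁ xⱼ⊏v′ = proj₁ (witness∥v′ N) (proj₁ xⱼ⊏v′)
          ...   | inj₂ u′⊏xᵢ = proj₂ xᵢ∥u′ (proj₁ u′⊏xᵢ)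

    narrowing⇒antichain : InfiniteAntichain P
    narrowing⇒antichain = sequence⇒antichain (λ n → witness (step n)) witnesses-∥

module ChainLemmas (em : ∀ {ℓ : Level} → ExcludedMiddle ℓ) (K : Chain) where
  open Classical em
  open Chain K using (C) renaming (_≤_ to _≼_; _<_ to _≺_)
  open IsTotalOrder (Chain.isTotal K) public
    using () renaming (total to ≼-total; trans to ≼-trans; antisym to ≼-antisym; refl to ≼-refl)

  ≺⇒¬≽ : ∀ {p q} → p ≺ q → ¬ q ≼ p
  ≺⇒¬≽ (p≼q , p≢q) q≼p = p≢q (≼-antisym p≼q q≼p)

  ¬≺⇒≽ : ∀ {p q} → ¬ p ≺ q → q ≼ p
  ¬≺⇒≽ {p} {q} p⊀q with ≼-total p q | em {P = p ≡ q}
  ... | inj₂ q≼p | _        = q≼p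
  ... | inj₁ _   | yes refl = ≼-refl
  ... | inj₁ p≼q | no p≢q   = ⊥-elim (p⊀q (p≼q , p≢q))

  Convex : (C → Set) → Set
  Convex X = ∀ p q r → X p → X r → p ≼ q → q ≼ r → X q

  private
    left-separated : ∀ {X B : C → Set} → Convex X → Convex B → (∀ p → X p → ¬ B p) →
      ∀ {q₀ p₀} → X q₀ → B p₀ → q₀ ≼ p₀ → ∀ q r → X q → B r → q ≺ r
    left-separated X-convex B-convex disjoint {q₀} {p₀} xq₀ bp₀ q₀≼p₀ q r xq br = dne λ q⊀r →
      [ (λ p₀≼q → disjoint p₀ (X-convex q₀ p₀ q xq₀ xq q₀≼p₀ p₀≼q) bp₀)
      , (λ q≼p₀ → disjoint q xq (B-convex r q p₀ br bp₀ (¬≺⇒≽ q⊀r) q≼p₀)) ] (≼-total p₀ q)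

  convex-disjoint⇒separated : ∀ {X B : C → Set} → Convex X → Convex B → (∀ p → X p → ¬ B p) →
    ∀ {q₀ p₀} → X q₀ → B p₀ → (∀ q r → X q → B r → q ≺ r) ⊎ (∀ r q → B r → X q → r ≺ q)
  convex-disjoint⇒separated X-convex B-convex disjoint {q₀} {p₀} xq₀ bp₀ with ≼-total q₀ p₀
  ... | inj₁ q₀≼p₀ = inj₁ (left-separated X-convex B-convex disjoint xq₀ bp₀ q₀≼p₀)
  ... | inj₂ p₀≼q₀ = inj₂ (left-separated B-convex X-convex (λ p bp xp → disjoint p xp bp) bp₀ xq₀ p₀≼q₀)

module IntervalOrderLemmas (em : ∀ {ℓ : Level} → ExcludedMiddle ℓ) (P : Poset)
  (interval-order : IsIntervalOrder P) where
  open Classical em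
  open Poset P
  open PosetLemmas em P

  private
    K : Chain
    K = proj₁ interval-order

  open Chain K public using (C) renaming (_≤_ to _≼_; _<_ to _≺_)
  open Chain K using (mem; nonempty; convex)
  open ChainLemmas em K public

  interval : V → Chain.Interval K
  interval = proj₁ (proj₂ interval-order)

  infix 4 _∈_ _⊆_

  _∈_ : C → V → Set
  p ∈ x = mem (interval x) p

  _⊆_ : V → V → Set
  x ⊆ y = ∀ p → p ∈ x → p ∈ y

  Meet : V → V → Set
  Meet x y = ∃[ p ] p ∈ x × p ∈ y

  point : ∀ x → ∃[ p ] p ∈ x
  point x = nonempty (interval x)

  interval-convex : ∀ x → Convex (_∈ x)
  interval-convex x = convex (interval x)

  ⊆-antisym : ∀ {x y} → x ⊆ y → y ⊆ x → x ≡ y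
  ⊆-antisym {x} {y} x⊆y y⊆x = proj₁ (proj₂ (proj₂ interval-order)) x y λ p → mk⇔ (x⊆y p) (y⊆x p)

  ⊏⇒≺ : ∀ {x y p q} → x ⊏ y → p ∈ x → q ∈ y → p ≺ q
  ⊏⇒≺ {x} {y} {p} {q} x⊏y = Equivalence.to (proj₂ (proj₂ (proj₂ interval-order)) x y) x⊏y p q

  ≺⇒⊏ : ∀ {x y} → (∀ p q → p ∈ x → q ∈ y → p ≺ q) → x ⊏ y
  ≺⇒⊏ {x} {y} = Equivalence.from (proj₂ (proj₂ (proj₂ interval-order)) x y)

  meet-sym : ∀ {x y} → Meet x y → Meet y x
  meet-sym (p , px , py) = p , py , px

  ⊆⇒meet : ∀ {x y} → x ⊆ y → Meet x y
  ⊆⇒meet {x} x⊆y = let p , px = point x in p , px , x⊆y p px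

  meet⇒¬⊏ : ∀ {x y} → Meet x y → ¬ x ⊏ y
  meet⇒¬⊏ (p , px , py) x⊏y = ≺⇒¬≽ (⊏⇒≺ x⊏y px py) ≼-refl

  ¬⊏⇒≽ : ∀ {x y} → ¬ x ⊏ y → ∃[ p ] ∃[ q ] p ∈ x × q ∈ y × q ≼ p
  ¬⊏⇒≽ x⋢y = dne λ none → x⋢y (≺⇒⊏ λ p q px qy → dne λ p⊀q → none (p , q , px , qy , ¬≺⇒≽ p⊀q))

  ¬⊏¬⊐⇒meet : ∀ {x y} → ¬ x ⊏ y → ¬ y ⊏ x → Meet x y
  ¬⊏¬⊐⇒meet {x} {y} x⋢y y⋢x with ¬⊏⇒≽ x⋢y | ¬⊏⇒≽ y⋢x
  ... | p , q , px , qy , q≼p | q′ , p′ , q′y , p′x , p′≼q′ with ≼-total p q′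
  ...   | inj₁ p≼q′ = p , px , interval-convex y q p q′ qy q′y q≼p p≼q′
  ...   | inj₂ q′≼p = q′ , interval-convex x p′ q′ p p′x px p′≼q′ q′≼p , q′y

  meet⇒∥ : ∀ {x y} → Meet x y → x ≢ y → x ∥ y
  meet⇒∥ m x≢y =
    (λ x≤y → meet⇒¬⊏ m (x≤y , x≢y)) , (λ y≤x → meet⇒¬⊏ (meet-sym m) (y≤x , λ y≡x → x≢y (sym y≡x)))

  ∥⇒meet : ∀ {x y} → x ∥ y → Meet x y
  ∥⇒meet (x≰y , y≰x) = ¬⊏¬⊐⇒meet (λ x⊏y → x≰y (proj₁ x⊏y)) (λ y⊏x → y≰x (proj₁ y⊏x))

  ¬meet⇒⊏⊎⊐ : ∀ {x y} → ¬ Meet x y → x ⊏ y ⊎ y ⊏ x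
  ¬meet⇒⊏⊎⊐ {x} {y} ¬m with em {P = x ⊏ y} | em {P = y ⊏ x}
  ... | yes x⊏y | _       = inj₁ x⊏y
  ... | no _    | yes y⊏x = inj₂ y⊏x
  ... | no x⋢y  | no y⋢x  = ⊥-elim (¬m (¬⊏¬⊐⇒meet x⋢y y⋢x))

  twoPlusTwoFree : TwoPlusTwoFree
  twoPlusTwoFree {a} {b} {c} {d} a⊏b c⊏d with em {P = a ⊏ d} | em {P = c ⊏ b}
  ... | yes a⊏d | _       = inj₁ a⊏d
  ... | no _    | yes c⊏b = inj₂ c⊏b
  ... | no a⋢d  | no c⋢b with ¬⊏⇒≽ a⋢d | ¬⊏⇒≽ c⋢b
  ...   | p , q , pa , qd , q≼p | p′ , q′ , p′c , q′b , q′≼p′ =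
    ⊥-elim (≺⇒¬≽ (⊏⇒≺ c⊏d p′c qd) (≼-trans q≼p (≼-trans (proj₁ (⊏⇒≺ a⊏b pa q′b)) q′≼p′)))

  ⊏-⊆ : ∀ {x y z} → x ⊏ y → z ⊆ y → x ⊏ z
  ⊏-⊆ x⊏y z⊆y = ≺⇒⊏ λ p q px qz → ⊏⇒≺ x⊏y px (z⊆y q qz)

  ⊐-⊆ : ∀ {x y z} → y ⊏ x → z ⊆ y → z ⊏ x
  ⊐-⊆ y⊏x z⊆y = ≺⇒⊏ λ p q pz qx → ⊏⇒≺ y⊏x (z⊆y p pz) qx

  Between : V → V → C → Set
  Between s s′ p = ∃[ p₁ ] ∃[ p₂ ] p₁ ∈ s × p₂ ∈ s′ × p₁ ≼ p × p ≼ p₂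

  Hull : V → V → V → Set
  Hull s s′ z = ∀ p → p ∈ z → Between s s′ p

  Shielded : V → V → Set
  Shielded s s′ = (∀ {w} → Meet w s → w ≢ s → w ∥ s′) × (∀ {w} → Meet w s′ → w ≢ s′ → w ∥ s)

  module _ {s s′ : V} (s⊏s′ : s ⊏ s′) (shielded : Shielded s s′) where

    private
      between-convex : Convex (Between s s′)
      between-convex p q r (p₁ , _ , p₁s , _ , p₁≼p , _) (_ , p₂ , _ , p₂s′ , _ , r≼p₂) p≼q q≼r =
        p₁ , p₂ , p₁s , p₂s′ , ≼-trans p₁≼p p≼q , ≼-trans q≼r r≼p₂

      s∈hull : Hull s s′ s
      s∈hull p ps = let q , qs′ = point s′ in p , q , ps , qs′ , ≼-refl , proj₁ (⊏⇒≺ s⊏s′ ps qs′)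

      s′∈hull : Hull s s′ s′
      s′∈hull p ps′ = let q , qs = point s in q , p , qs , ps′ , proj₁ (⊏⇒≺ s⊏s′ qs ps′) , ≼-refl

      straddle⇒meet : ∀ {x h q} → h ∈ x → Between s s′ h → q ∈ x → ¬ Between s s′ q → Meet x s ⊎ Meet x s′
      straddle⇒meet {x} {h} {q} hx (p₁ , p₂ , p₁s , p₂s′ , p₁≼h , h≼p₂) qx q∉ with ≼-total q h
      ... | inj₁ q≼h =
        [ (λ q≼p₁ → inj₁ (p₁ , interval-convex x q p₁ h qx hx q≼p₁ p₁≼h , p₁s))
        , (λ p₁≼q → ⊥-elim (q∉ (p₁ , p₂ , p₁s , p₂s′ , p₁≼q , ≼-trans q≼h h≼p₂))) ] (≼-total q p₁)
      ... | inj₂ h≼q =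
        [ (λ p₂≼q → inj₂ (p₂ , interval-convex x h p₂ q hx qx h≼p₂ p₂≼q , p₂s′))
        , (λ q≼p₂ → ⊥-elim (q∉ (p₁ , p₂ , p₁s , p₂s′ , ≼-trans p₁≼h h≼q , q≼p₂))) ] (≼-total p₂ q)

      module _ {x : V} (x∥s : x ∥ s) (x∥s′ : x ∥ s′) {z : V} (z∈hull : Hull s s′ z) where

        ¬⊏hull : ¬ x ⊏ z
        ¬⊏hull x⊏z =
          let p′ , p′x , p′s′ = ∥⇒meet x∥s′
              r , rz = point z
              _ , p₂ , _ , p₂s′ , _ , r≼p₂ = z∈hull r rz
              z-meets-s′ = r , rz , interval-convex s′ p′ r p₂ p′s′ p₂s′ (proj₁ (⊏⇒≺ x⊏z p′x rz)) r≼p₂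
          in case em {P = z ≡ s′} of λ
            { (yes refl) → proj₁ x∥s′ (proj₁ x⊏z)
            ; (no z≢s′)  → let q , qz , qs = ∥⇒meet (proj₂ shielded z-meets-s′ z≢s′)
                           in ≺⇒¬≽ (⊏⇒≺ x⊏z p′x qz) (proj₁ (⊏⇒≺ s⊏s′ qs p′s′)) }

        ¬hull⊏ : ¬ z ⊏ x
        ¬hull⊏ z⊏x =
          let p , px , ps = ∥⇒meet x∥s
              r , rz = point z
              p₁ , _ , p₁s , _ , p₁≼r , _ = z∈hull r rz
              z-meets-s = r , rz , interval-convex s p₁ r p p₁s ps p₁≼r (proj₁ (⊏⇒≺ z⊏x rz px))
          in case em {P = z ≡ s} of λ
            { (yes refl) → proj₂ x∥s (proj₁ z⊏x)
            ; (no z≢s)   → let q , qz , qs′ = ∥⇒meet (proj₁ shielded z-meets-s z≢s)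
                           in ≺⇒¬≽ (⊏⇒≺ z⊏x qz px) (proj₁ (⊏⇒≺ s⊏s′ ps qs′)) }

    hull-uniform : ∀ x → ¬ Hull s s′ x → Uniform (Hull s s′) x
    hull-uniform x x∉hull with em {P = ∃[ h ] h ∈ x × Between s s′ h}
    ... | yes (h , hx , h-between) =
      let q , qx , q∉ = ¬∀⇒∃¬ x∉hull
          x∥s , x∥s′ = ∥-both (straddle⇒meet hx h-between qx q∉)
      in apart λ z z∈hull → ¬⊏¬⊐⇒∥ (λ x≡z → x∉hull (subst (Hull s s′) (sym x≡z) z∈hull))
                                   (¬⊏hull x∥s x∥s′ z∈hull) (¬hull⊏ x∥s x∥s′ z∈hull)
      where
        ∥-both : Meet x s ⊎ Meet x s′ → x ∥ s × x ∥ s′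
        ∥-both (inj₁ x-meets-s) =
          let x≢s = λ { refl → x∉hull s∈hull }
          in meet⇒∥ x-meets-s x≢s , proj₁ shielded x-meets-s x≢s
        ∥-both (inj₂ x-meets-s′) =
          let x≢s′ = λ { refl → x∉hull s′∈hull }
          in proj₂ shielded x-meets-s′ x≢s′ , meet⇒∥ x-meets-s′ x≢s′
    ... | no disjoint
      with convex-disjoint⇒separated (interval-convex x) between-convex (λ p px pB → disjoint (p , px , pB))
             (proj₂ (point x)) (s∈hull _ (proj₂ (point s)))
    ...   | inj₁ x≺hull = below λ z z∈hull → proj₁ (≺⇒⊏ λ p q px qz → x≺hull p q px (z∈hull q qz))
    ...   | inj₂ hull≺x = above λ z z∈hull → proj₁ (≺⇒⊏ λ p q pz qx → hull≺x p q (z∈hull p pz) qx)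

    prime⇒shielded-minimal : IsPrime P → ∀ {u} → ¬ u ⊏ s
    prime⇒shielded-minimal prime {u} u⊏s =
      let u∈hull = prime-module-full prime (uniform⇒module hull-uniform) s∈hull s′∈hull (proj₂ s⊏s′) u
          p , pu = point u
          p₁ , _ , p₁s , _ , p₁≼p , _ = u∈hull p pu
      in ≺⇒¬≽ (⊏⇒≺ u⊏s pu p₁s) p₁≼p

module PrimeTwoPlusTwoFree (em : ∀ {ℓ : Level} → ExcludedMiddle ℓ) (P : Poset)
  (prime : IsPrime P) (2+2-free : PosetLemmas.TwoPlusTwoFree em P) where
  open Classical em
  open Poset P
  open PosetLemmas em P

  module _ (g : ℚ → V) (g-embedding : ∀ p q → (p ℚ.≤ q) ⇔ (g p ≤ g q)) where

    g-mono : ∀ {p q} → p ℚ.< q → g p ⊏ g q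
    g-mono {p} {q} p<q =
      Equivalence.to (g-embedding p q) (ℚₚ.<⇒≤ p<q) ,
      λ gp≡gq → ℚₚ.<-irrefl refl
        (ℚₚ.<-≤-trans p<q (Equivalence.from (g-embedding q p) (subst (_≤ g p) gp≡gq ≤-refl)))

    Image : V → V → Set
    Image u v = ∃[ a ] ∃[ b ] a ℚ.< b × g a ≡ u × g b ≡ v

    module _ {a b : ℚ} (a<b : a ℚ.< b) (¬narrowing : ¬ Narrowing Image (g a) (g b)) where

      private
        In : ℚ → Set
        In q = a ℚ.< q × q ℚ.< b

        Span : V → Set
        Span z = ∃[ r ] ∃[ s ] In r × In s × g r ⊏ z × z ⊏ g s

        span-image : ∀ {q} → In q → Span (g q)
        span-image {q} (a<q , q<b) =
          let r , a<r , r<q = ℚₚ.<-dense a<q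
              s , q<s , s<b = ℚₚ.<-dense q<b
          in r , s , (a<r , ℚₚ.<-trans r<q q<b) , (ℚₚ.<-trans a<q q<s , s<b) , g-mono r<q , g-mono q<s

        -- otherwise x is incomparable to g r and g s, and witnesses a narrowing
        comparable-to-one : ∀ {x t r s} → ¬ Span x → In t → Comparable x (g t) → In r → In s → r ℚ.< s →
          (g r ⊏ x ⊎ x ⊏ g r) ⊎ (g s ⊏ x ⊎ x ⊏ g s)
        comparable-to-one {x} {t} {r} {s} x∉span (a<t , t<b) x~t (a<r , r<b) (a<s , s<b) r<s = dne λ neither →
          ¬narrowing record
            { u′ = g r ; v′ = g s ; witness = x ; probe = g t
            ; u⊏u′ = g-mono a<r ; u′⊏v′ = g-mono r<s ; v′⊏v = g-mono s<b
            ; witness∥u′ = ∥-image (a<r , r<b) λ c → neither (inj₁ c)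
            ; witness∥v′ = ∥-image (a<s , s<b) λ c → neither (inj₂ c)
            ; u⊏probe = g-mono a<t ; probe⊏v = g-mono t<b ; witness~probe = x~t
            ; good = r , s , r<s , refl , refl }
          where
            ∥-image : ∀ {q} → In q → ¬ (g q ⊏ x ⊎ x ⊏ g q) → x ∥ g q
            ∥-image q∈ ¬c = ¬⊏¬⊐⇒∥ (λ x≡gq → x∉span (subst Span (sym x≡gq) (span-image q∈)))
                                    (λ x⊏ → ¬c (inj₂ x⊏)) (λ ⊏x → ¬c (inj₁ ⊏x))

        module _ {x : V} {t : ℚ} (x∉span : ¬ Span x) (t∈ : In t) (x~t : Comparable x (g t)) where

          above-all : ¬ (∃[ s ] In s × x ⊏ g s) → ∀ {s} → In s → g s ⊏ x
          above-all ¬D {s} (a<s , s<b) with ℚₚ.<-dense s<b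
          ... | s′ , s<s′ , s′<b
            with comparable-to-one x∉span t∈ x~t (a<s , s<b) (ℚₚ.<-trans a<s s<s′ , s′<b) s<s′
          ...   | inj₁ (inj₁ gs⊏x)  = gs⊏x
          ...   | inj₁ (inj₂ x⊏gs)  = ⊥-elim (¬D (s , (a<s , s<b) , x⊏gs))
          ...   | inj₂ (inj₁ gs′⊏x) = ⊏-trans (g-mono s<s′) gs′⊏x
          ...   | inj₂ (inj₂ x⊏gs′) = ⊥-elim (¬D (s′ , (ℚₚ.<-trans a<s s<s′ , s′<b) , x⊏gs′))

          below-all : ¬ (∃[ r ] In r × g r ⊏ x) → ∀ {r} → In r → x ⊏ g r
          below-all ¬U {r} (a<r , r<b) with ℚₚ.<-dense a<r
          ... | r′ , a<r′ , r′<r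
            with comparable-to-one x∉span t∈ x~t (a<r′ , ℚₚ.<-trans r′<r r<b) (a<r , r<b) r′<r
          ...   | inj₁ (inj₁ gr′⊏x) = ⊥-elim (¬U (r′ , (a<r′ , ℚₚ.<-trans r′<r r<b) , gr′⊏x))
          ...   | inj₁ (inj₂ x⊏gr′) = ⊏-trans x⊏gr′ (g-mono r′<r)
          ...   | inj₂ (inj₁ gr⊏x)  = ⊥-elim (¬U (r , (a<r , r<b) , gr⊏x))
          ...   | inj₂ (inj₂ x⊏gr)  = x⊏gr

        uniform : ∀ x → ¬ Span x → Uniform Span x
        uniform x x∉span with em {P = ∃[ t ] In t × Comparable x (g t)}
        ... | no ¬comparable = apart λ z (r , s , r∈ , s∈ , gr⊏z , z⊏gs) →
          (λ x≤z → ¬comparable (s , s∈ , inj₁ (proj₁ (≤-⊏-trans x≤z z⊏gs)))) ,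
          (λ z≤x → ¬comparable (r , r∈ , inj₂ (proj₁ (⊏-≤-trans gr⊏z z≤x))))
        ... | yes (t , t∈ , x~t) with em {P = ∃[ s ] In s × x ⊏ g s} | em {P = ∃[ r ] In r × g r ⊏ x}
        ...   | no ¬D                 | _     = above λ z (_ , s , _ , s∈ , _ , z⊏gs) →
          proj₁ (⊏-trans z⊏gs (above-all x∉span t∈ x~t ¬D s∈))
        ...   | yes _                 | no ¬U = below λ z (r , _ , r∈ , _ , gr⊏z , _) →
          proj₁ (⊏-trans (below-all x∉span t∈ x~t ¬U r∈) gr⊏z)
        ...   | yes (s , s∈ , x⊏gs) | yes (r , r∈ , gr⊏x) = ⊥-elim (x∉span (r , s , r∈ , s∈ , gr⊏x , x⊏gs))

      ¬¬image-narrowing : ⊥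
      ¬¬image-narrowing =
        let q₁ , a<q₁ , q₁<b = ℚₚ.<-dense a<b
            q₂ , q₁<q₂ , q₂<b = ℚₚ.<-dense q₁<b
            _ , _ , (a<r , _) , _ , gr⊏ga , _ =
              prime-module-full prime (uniform⇒module uniform) (span-image (a<q₁ , q₁<b))
                (span-image (ℚₚ.<-trans a<q₁ q₁<q₂ , q₂<b)) (proj₂ (g-mono q₁<q₂)) (g a)
        in ⊏-asym (g-mono a<r) gr⊏ga

    embedding⇒antichain : InfiniteAntichain P
    embedding⇒antichain =
      narrowing⇒antichain 2+2-free Image (g 0ℚ , g 1ℚ , 0ℚ , 1ℚ , ℚₚ.positive⁻¹ 1ℚ , refl , refl) narrow
      where
        narrow : ∀ {u v} → Image u v → Narrowing Image u v
        narrow (a , b , a<b , refl , refl) = dne (¬¬image-narrowing a<b)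

  antichain-free⇒scattered : NoInfiniteAntichain P → Scattered P
  antichain-free⇒scattered noAntichain (g , g-embedding) = noAntichain (embedding⇒antichain g g-embedding)

module PrimeIntervalOrder (em : ∀ {ℓ : Level} → ExcludedMiddle ℓ) (P : Poset)
  (interval-order : IsIntervalOrder P) (prime : IsPrime P) (noAntichain : NoInfiniteAntichain P) where
  open Classical em
  open Poset P
  open PosetLemmas em P
  open IntervalOrderLemmas em P interval-order

  Crossing : V → V → Set
  Crossing y z = Meet y z × ¬ z ⊆ y × ¬ y ⊆ z

  crossing-sym : ∀ {y z} → Crossing y z → Crossing z y
  crossing-sym (m , z⊈y , y⊈z) = meet-sym m , y⊈z , z⊈y

  module Overhangs (_⊴_ : C → C → Set) (⊴-total : ∀ p q → p ⊴ q ⊎ q ⊴ p)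
                   (⊴-convex : ∀ x p q r → p ∈ x → r ∈ x → p ⊴ q → q ⊴ r → q ∈ x) where

    Overhang : V → V → Set
    Overhang y z = ∃[ d ] ∃[ e ] d ∈ z × ¬ d ∈ y × e ∈ z × e ∈ y × d ⊴ e

    private
      meet-at : ∀ {y z z′ e d′ e′} → e ∈ z → e ∈ y → d′ ∈ z′ → ¬ d′ ∈ y → e′ ∈ z′ → e′ ∈ y →
        d′ ⊴ e′ → e ⊴ e′ → Meet z z′
      meet-at {y} {z} {z′} {e} {d′} {e′} ez ey d′z′ d′∉y e′z′ e′y d′⊴e′ e⊴e′ with ⊴-total d′ e
      ... | inj₁ d′⊴e = e , ez , ⊴-convex z′ d′ e e′ d′z′ e′z′ d′⊴e e⊴e′
      ... | inj₂ e⊴d′ = ⊥-elim (d′∉y (⊴-convex y e d′ e′ ey e′y e⊴d′ d′⊴e′))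

    overhangs-meet : ∀ {y z z′} → Overhang y z → Overhang y z′ → Meet z z′
    overhangs-meet (d , e , dz , d∉y , ez , ey , d⊴e) (d′ , e′ , d′z′ , d′∉y , e′z′ , e′y , d′⊴e′)
      with ⊴-total e e′
    ... | inj₁ e⊴e′ = meet-at ez ey d′z′ d′∉y e′z′ e′y d′⊴e′ e⊴e′
    ... | inj₂ e′⊴e = meet-sym (meet-at e′z′ e′y dz d∉y ez ey d⊴e e′⊴e)

    overhang-countable : ∀ y → Countable (Overhang y)
    overhang-countable y = antichain-countable noAntichain λ oz oz′ → meet⇒∥ (overhangs-meet oz oz′)

  private
    module Left  = Overhangs _≼_ ≼-total interval-convex
    module Right = Overhangs (flip _≼_) (flip ≼-total)
                     (λ x p q r px rx q≼p r≼q → interval-convex x r q p rx px r≼q q≼p)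

  crossing-countable : ∀ y → Countable (Crossing y)
  crossing-countable y =
    countable-⊆ crossing⇒overhang (countable-∪ (Left.overhang-countable y) (Right.overhang-countable y))
    where
      crossing⇒overhang : ∀ z → Crossing y z → Left.Overhang y z ⊎ Right.Overhang y z
      crossing⇒overhang z ((e , ey , ez) , z⊈y , _) with ¬∀⇒∃¬ z⊈y
      ... | d , dz , d∉y with ≼-total d e
      ...   | inj₁ d≼e = inj₁ (d , e , dz , d∉y , ez , ey , d≼e)
      ...   | inj₂ e≼d = inj₂ (d , e , dz , d∉y , ez , ey , e≼d)

  Path : V → ℕ → V → Set
  Path x zero    z = z ≡ x
  Path x (suc k) z = ∃[ y ] Path x k y × Crossing y z

  Connected : V → V → Set
  Connected x z = ∃[ k ] Path x k z

  connected-countable : ∀ x → Countable (Connected x)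
  connected-countable x = countable-⋃ path-countable
    where
      path-countable : ∀ k → Countable (Path x k)
      path-countable zero    = countable-singleton x
      path-countable (suc k) = countable-⋃-indexed (path-countable k) crossing-countable

  connected-refl : ∀ {x} → Connected x x
  connected-refl = zero , refl

  connected-step : ∀ {x y z} → Connected x y → Crossing y z → Connected x z
  connected-step (k , path) cross = suc k , _ , path , cross

  connected-trans : ∀ {x y z} → Connected x y → Connected y z → Connected x z
  connected-trans x~y (zero , refl)            = x~y
  connected-trans x~y (suc k , _ , path , cross) = connected-step (connected-trans x~y (k , path)) cross

  connected-sym : ∀ {x y} → Connected x y → Connected y x
  connected-sym (zero , refl)              = connected-refl
  connected-sym (suc k , _ , path , cross) =
    connected-trans (connected-step connected-refl (crossing-sym cross)) (connected-sym (k , path))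

  connected-ind : ∀ {x} (Q : V → Set) → (∀ {u u′} → Connected x u → Crossing u u′ → Q u → Q u′) →
    Q x → ∀ {y} → Connected x y → Q y
  connected-ind Q step qx (zero , refl)              = qx
  connected-ind Q step qx (suc k , _ , path , cross) =
    step (k , path) cross (connected-ind Q step qx (k , path))

  Covered : V → V → Set
  Covered x z = ∃[ y ] Connected x y × z ⊆ y

  module _ (x₀ : V) where

    contains-member⇒contains-component : ∀ {w y y′} → ¬ Connected x₀ w →
      Connected x₀ y → y ⊆ w → Connected x₀ y′ → y′ ⊆ w
    contains-member⇒contains-component {w} {y} ¬x₀~w x₀~y y⊆w x₀~y′ =
      connected-ind (_⊆ w) step y⊆w (connected-trans (connected-sym x₀~y) x₀~y′)
      where
        step : ∀ {u u′} → Connected y u → Crossing u u′ → u ⊆ w → u′ ⊆ w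
        step y~u cross@((p , pu , pu′) , _ , u⊈u′) u⊆w = dne λ u′⊈w →
          let w⊈u′ = λ w⊆u′ → u⊈u′ λ q qu → w⊆u′ q (u⊆w q qu)
          in ¬x₀~w (connected-trans x₀~y
               (connected-step (connected-step y~u cross) ((p , pu′ , u⊆w p pu) , w⊈u′ , u′⊈w)))

    disjoint-component⇒side : ∀ {x} → (∀ {y} → Connected x₀ y → ¬ Meet x y) →
      (∀ {y} → Connected x₀ y → x ⊏ y) ⊎ (∀ {y} → Connected x₀ y → y ⊏ x)
    disjoint-component⇒side {x} disjoint with ¬meet⇒⊏⊎⊐ (disjoint connected-refl)
    ... | inj₁ x⊏x₀ = inj₁ (connected-ind (x ⊏_) below-step x⊏x₀)
      where
        below-step : ∀ {u u′} → Connected x₀ u → Crossing u u′ → x ⊏ u → x ⊏ u′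
        below-step x₀~u cross x⊏u with ¬meet⇒⊏⊎⊐ (disjoint (connected-step x₀~u cross))
        ... | inj₁ x⊏u′ = x⊏u′
        ... | inj₂ u′⊏x = ⊥-elim (meet⇒¬⊏ (meet-sym (proj₁ cross)) (⊏-trans u′⊏x x⊏u))
    ... | inj₂ x₀⊏x = inj₂ (connected-ind (_⊏ x) above-step x₀⊏x)
      where
        above-step : ∀ {u u′} → Connected x₀ u → Crossing u u′ → u ⊏ x → u′ ⊏ x
        above-step x₀~u cross u⊏x with ¬meet⇒⊏⊎⊐ (disjoint (connected-step x₀~u cross))
        ... | inj₁ x⊏u′ = ⊥-elim (meet⇒¬⊏ (proj₁ cross) (⊏-trans u⊏x x⊏u′))
        ... | inj₂ u′⊏x = u′⊏x

    covered-uniform : ∀ x → ¬ Covered x₀ x → Uniform (Covered x₀) x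
    covered-uniform x ¬covered with em {P = ∃[ y ] Connected x₀ y × Meet x y}
    ... | yes (y , x₀~y , x-meets-y) = apart λ z (y′ , x₀~y′ , z⊆y′) →
      let y′⊆x = contains-member⇒contains-component ¬x₀~x x₀~y y⊆x x₀~y′
          z≢x  = λ z≡x → ¬covered (subst (Covered x₀) z≡x (y′ , x₀~y′ , z⊆y′))
      in ∥-sym (meet⇒∥ (⊆⇒meet λ p pz → y′⊆x p (z⊆y′ p pz)) z≢x)
      where
        ¬x₀~x : ¬ Connected x₀ x
        ¬x₀~x x₀~x = ¬covered (x , x₀~x , λ _ p → p)
        y⊆x : y ⊆ x
        y⊆x = dne λ y⊈x → ¬x₀~x (connected-step x₀~y
                (meet-sym x-meets-y , (λ x⊆y → ¬covered (y , x₀~y , x⊆y)) , y⊈x))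
    ... | no disjoint with disjoint-component⇒side (λ x₀~y x-meets-y → disjoint (_ , x₀~y , x-meets-y))
    ...   | inj₁ below-all = below λ z (y , x₀~y , z⊆y) → proj₁ (⊏-⊆ (below-all x₀~y) z⊆y)
    ...   | inj₂ above-all = above λ z (y , x₀~y , z⊆y) → proj₁ (⊐-⊆ (above-all x₀~y) z⊆y)

  Atom : V → Set
  Atom z = ∀ y → Meet z y → z ⊆ y

  non-atom⇒covers : ∀ {x₀} → ¬ Atom x₀ → ∀ z → Covered x₀ z
  non-atom⇒covers {x₀} ¬atom with ¬∀⇒∃¬ ¬atom
  ... | y , m , x₀⊈y =
    prime-module-full prime (uniform⇒module (covered-uniform x₀))
      (x₀ , connected-refl , λ _ p → p) y-covered (λ { refl → x₀⊈y λ _ p → p })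
    where
      y-covered : Covered x₀ y
      y-covered with em {P = y ⊆ x₀}
      ... | yes y⊆x₀ = x₀ , connected-refl , y⊆x₀
      ... | no y⊈x₀  = y , connected-step connected-refl (m , y⊈x₀ , x₀⊈y) , λ _ p → p

  non-atoms-connected : ∀ {x₀ z} → ¬ Atom x₀ → ¬ Atom z → Connected x₀ z
  non-atoms-connected {x₀} {z} ¬atom₀ ¬atom = dne λ ¬x₀~z →
    let y₀ , x₀~y₀ , z⊆y₀  = non-atom⇒covers ¬atom₀ z
        y₁ , z~y₁  , y₀⊆y₁ = non-atom⇒covers ¬atom y₀
        ¬x₀~y₁ = λ x₀~y₁ → ¬x₀~z (connected-trans x₀~y₁ (connected-sym z~y₁))
        y₂ , x₀~y₂ , y₁⊆y₂ = non-atom⇒covers ¬atom₀ y₁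
        y₂⊆y₁ = contains-member⇒contains-component x₀ ¬x₀~y₁ x₀~y₀ y₀⊆y₁ x₀~y₂
    in ¬x₀~y₁ (subst (Connected x₀) (⊆-antisym y₂⊆y₁ y₁⊆y₂) x₀~y₂)

  record AtomDecomposition : Set₁ where
    field
      Core           : V → Set
      core-countable : Countable Core
      base           : V
      base∈core      : Core base
      outside-atom   : ∀ {z} → ¬ Core z → Atom z

  decomposition : V → AtomDecomposition
  decomposition v with em {P = ∃[ x ] ¬ Atom x}
  ... | yes (x₀ , ¬atom₀) = record
    { Core = Connected x₀ ; core-countable = connected-countable x₀ ; base = x₀ ; base∈core = connected-refl
    ; outside-atom = λ ¬x₀~z → dne λ ¬atom → ¬x₀~z (non-atoms-connected ¬atom₀ ¬atom) }
  ... | no all-atoms = record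
    { Core = _≡ v ; core-countable = countable-singleton v ; base = v ; base∈core = refl
    ; outside-atom = λ {z} _ → dne λ ¬atom → all-atoms (z , ¬atom) }

  module _ (D : AtomDecomposition) where
    open AtomDecomposition D

    Outer : V → Set
    Outer z = ¬ Core z

    private
      outer-meet⇒≡ : ∀ {s s′} → Outer s → Outer s′ → Meet s s′ → s ≡ s′
      outer-meet⇒≡ os os′ m = ⊆-antisym (outside-atom os _ m) (outside-atom os′ _ (meet-sym m))

      outer-chain : ∀ {s s′} → Outer s → Outer s′ → s ≢ s′ → s ⊏ s′ ⊎ s′ ⊏ s
      outer-chain os os′ s≢s′ = ¬meet⇒⊏⊎⊐ λ m → s≢s′ (outer-meet⇒≡ os os′ m)

      meets-outer⇒core : ∀ {s w} → Outer s → Meet w s → w ≢ s → Core w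
      meets-outer⇒core os m w≢s = dne λ ow → w≢s (outer-meet⇒≡ ow os m)

      Cut : Bool × V → V → Set
      Cut (true  , w) s = w ⊏ s
      Cut (false , w) s = ¬ s ⊏ w

      cut-upward : ∀ i {a b} → Cut i a → a ⊏ b → Cut i b
      cut-upward (true  , w) w⊏a a⊏b     = ⊏-trans w⊏a a⊏b
      cut-upward (false , w) a⋢w a⊏b b⊏w = a⋢w (⊏-trans a⊏b b⊏w)

      CoreCut : Bool × V → Set
      CoreCut i = Core (proj₂ i)

      core-cuts-countable : Countable CoreCut
      core-cuts-countable =
        countable-⊆ tag (countable-⋃-indexed core-countable λ w →
          countable-∪ (countable-singleton (true , w)) (countable-singleton (false , w)))
        where
          tag : ∀ i → CoreCut i → ∃[ w ] Core w × (i ≡ (true , w) ⊎ i ≡ (false , w))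
          tag (true  , w) cw = w , cw , inj₁ refl
          tag (false , w) cw = w , cw , inj₂ refl

      -- otherwise the outer elements between s and s′ would form a nontrivial module
      outer-separated : ∀ {s s′} → Outer s → Outer s′ → s ⊏ s′ → ∃[ i ] CoreCut i × Cut i s′ × ¬ Cut i s
      outer-separated {s} {s′} os os′ s⊏s′ = dne λ inseparable →
        proj₁ (prime-module-full prime (uniform⇒module (uniform inseparable))
                 (os , ≤-refl , proj₁ s⊏s′) (os′ , proj₁ s⊏s′ , ≤-refl) (proj₂ s⊏s′) base) base∈core
        where
          S : V → Set
          S z = Outer z × s ≤ z × z ≤ s′

          uniform : ¬ (∃[ i ] CoreCut i × Cut i s′ × ¬ Cut i s) → ∀ x → ¬ S x → Uniform S x
          uniform _ x ¬Sx with em {P = Core x}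
          uniform _ x ¬Sx | no ox with outer-chain ox os (λ { refl → ¬Sx (os , ≤-refl , proj₁ s⊏s′) })
          ... | inj₁ x⊏s = below λ z (_ , s≤z , _) → proj₁ (⊏-≤-trans x⊏s s≤z)
          ... | inj₂ s⊏x with outer-chain ox os′ (λ { refl → ¬Sx (os′ , proj₁ s⊏s′ , ≤-refl) })
          ...   | inj₁ x⊏s′ = ⊥-elim (¬Sx (ox , proj₁ s⊏x , proj₁ x⊏s′))
          ...   | inj₂ s′⊏x = above λ z (_ , _ , z≤s′) → proj₁ (≤-⊏-trans z≤s′ s′⊏x)
          uniform inseparable x ¬Sx | yes cx with em {P = x ⊏ s} | em {P = s ⊏ x}
          ... | yes x⊏s | _   = below λ z (_ , s≤z , _) → proj₁ (⊏-≤-trans x⊏s s≤z)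
          ... | no _ | yes s⊏x = above λ z (_ , _ , z≤s′) → proj₁ (≤-⊏-trans z≤s′ s′⊏x)
            where
              s′⊏x : s′ ⊏ x
              s′⊏x = dne λ s′⋢x → inseparable ((false , x) , cx , s′⋢x , λ s⋢x → s⋢x s⊏x)
          ... | no x⋢s | no s⋢x = apart λ z Sz@(_ , s≤z , z≤s′) →
            ¬⊏¬⊐⇒∥ (λ x≡z → ¬Sx (subst S (sym x≡z) Sz))
              (λ x⊏z → inseparable ((true , x) , cx , ⊏-≤-trans x⊏z z≤s′ , x⋢s))
              (λ z⊏x → s⋢x (≤-⊏-trans s≤z z⊏x))

      uncountable-outer⇒segment : ∀ {Y} → (∀ {z} → Y z → Outer z) → ¬ Countable Y →
        ∃[ a ] ∃[ b ] Y a × Y b × a ⊏ b × ¬ Countable (Segment Y a b)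
      uncountable-outer⇒segment Y⊆outer =
        uncountable-chain⇒uncountable-segment Cut core-cuts-countable cut-upward
          (λ ya yb → outer-chain (Y⊆outer ya) (Y⊆outer yb))
          (λ ya yb → outer-separated (Y⊆outer ya) (Y⊆outer yb))

    Thick : V → V → Set
    Thick u v = Outer u × Outer v × u ⊏ v × ¬ Countable (Segment Outer u v)

    module _ {u v : V} (thick : Thick u v) (¬narrowing : ¬ Narrowing Thick u v) where

      private
        Inner : V → Set
        Inner = Segment Outer u v

        Full : V → Set
        Full w = ∀ z → Inner z → w ∥ z

        Apart : V → V → Set
        Apart w z = Inner z × w ∥ z

        -- otherwise an uncountable segment of Apart w yields a narrowing witnessed by w
        apart-countable : ∀ {w} → ¬ Full w → Countable (Apart w)
        apart-countable {w} ¬full = dne λ ¬countable →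
          narrowing-from (uncountable-outer⇒segment (λ apart → proj₁ (proj₁ apart)) ¬countable) (¬∀⇒∃¬ ¬full)
          where
            narrowing-from :
              ∃[ a ] ∃[ b ] Apart w a × Apart w b × a ⊏ b × ¬ Countable (Segment (Apart w) a b) →
              ∃[ t ] Inner t × ¬ w ∥ t → ⊥
            narrowing-from (a , b , (oa , w∥a) , (ob , w∥b) , a⊏b , ¬countable-ab) (t , ot , ¬w∥t) =
              ¬narrowing record
                { u′ = a ; v′ = b ; witness = w ; probe = t
                ; u⊏u′ = proj₁ (proj₂ oa) ; u′⊏v′ = a⊏b ; v′⊏v = proj₂ (proj₂ ob)
                ; witness∥u′ = w∥a ; witness∥v′ = w∥b
                ; u⊏probe = proj₁ (proj₂ ot) ; probe⊏v = proj₂ (proj₂ ot)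
                ; witness~probe = ¬∥⇒comparable ¬w∥t
                ; good = proj₁ oa , proj₁ ob , a⊏b ,
                         λ countable-ab → ¬countable-ab (countable-⊆ shrink countable-ab) }
              where
                shrink : ∀ z → Segment (Apart w) a b z → Segment Outer a b z
                shrink z ((oz , _) , a⊏z , z⊏b) = proj₁ oz , a⊏z , z⊏b

        Bad : V → Set
        Bad z = ∃[ w ] Core w × (¬ Full w × Apart w z)

        bad-countable : Countable Bad
        bad-countable = countable-⋃-indexed core-countable λ w → by-fullness w em
          where
            by-fullness : ∀ w → Dec (Full w) → Countable (λ z → ¬ Full w × Apart w z)
            by-fullness w (yes full) = countable-∅ λ z (¬full , _) → ¬full full
            by-fullness w (no ¬full) = countable-⊆ (λ z → proj₂) (apart-countable ¬full)

        Clean : V → Set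
        Clean z = Inner z × ¬ Bad z

        clean-uncountable : ¬ Countable Clean
        clean-uncountable countable-clean =
          proj₂ (proj₂ (proj₂ thick)) (countable-by-parts bad-countable countable-clean)

        meets-clean⇒full : ∀ {s w} → Clean s → Meet w s → w ≢ s → Full w
        meets-clean⇒full (os , ¬bad) m w≢s = dne λ ¬full →
          ¬bad (_ , meets-outer⇒core (proj₁ os) m w≢s , ¬full , os , meet⇒∥ m w≢s)

        clean-shielded : ∀ {s s′} → Clean s → Clean s′ → Shielded s s′
        clean-shielded cs cs′ =
          (λ m w≢s → meets-clean⇒full cs m w≢s _ (proj₁ cs′)) ,
          (λ m w≢s′ → meets-clean⇒full cs′ m w≢s′ _ (proj₁ cs))

        ordered-clean-absurd : ∀ {s s′} → Clean s → Clean s′ → s ⊏ s′ → ⊥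
        ordered-clean-absurd cs cs′ s⊏s′ =
          prime⇒shielded-minimal s⊏s′ (clean-shielded cs cs′) prime (proj₁ (proj₂ (proj₁ cs)))

      ¬¬thick-narrowing : ⊥
      ¬¬thick-narrowing =
        let s , s′ , cs , cs′ , s≢s′ = uncountable⇒distinct clean-uncountable
        in [ ordered-clean-absurd cs cs′ , ordered-clean-absurd cs′ cs ]
             (outer-chain (proj₁ (proj₁ cs)) (proj₁ (proj₁ cs′)) s≢s′)

    thick-narrowing : ∀ {u v} → Thick u v → Narrowing Thick u v
    thick-narrowing thick = dne (¬¬thick-narrowing thick)

    uncountable⇒thick : ¬ Countable {V} (λ _ → ⊤) → ∃[ u ] ∃[ v ] Thick u v
    uncountable⇒thick ¬countable = uncountable-outer⇒segment id outer-uncountable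
      where
        outer-uncountable : ¬ Countable Outer
        outer-uncountable countable-outer =
          ¬countable (countable-by-parts core-countable (countable-⊆ (λ _ → proj₂) countable-outer))

  antichain-free⇒countable : AtMostCountable P
  antichain-free⇒countable with em {P = Countable {V} (λ _ → ⊤)}
  ... | yes countable  = countable-universe⇒injection countable
  ... | no ¬countable = ⊥-elim (noAntichain
    (narrowing⇒antichain twoPlusTwoFree (Thick D) (uncountable⇒thick D ¬countable) (thick-narrowing D)))
    where
      D : AtomDecomposition
      D = decomposition (proj₁ (uncountable⇒nonempty ¬countable))

theorem1p4 : (em : ∀ {ℓ : Level} → ExcludedMiddle ℓ) → (P : Poset) →
    IsIntervalOrder P → IsPrime P → NoInfiniteAntichain P →
    AtMostCountable P × Scattered P
theorem1p4 em P interval-order prime noAntichain =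
  PrimeIntervalOrder.antichain-free⇒countable em P interval-order prime noAntichain ,
  PrimeTwoPlusTwoFree.antichain-free⇒scattered em P prime
    (IntervalOrderLemmas.twoPlusTwoFree em P interval-order) noAntichain
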